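{- Let $f=\prod_{k=1}^t p_k^{e_k}$ (with $t\geq 1$, $e_k\geq 1$) be an integer all of whose $t$ distinct prime divisors $p_k$ satisfy $p_k\equiv 1\pmod 3$. Then the set $$E_f:=\{a/b\in(\mathbb{Z}/f\mathbb{Z})^*;\ f=a^2+ab+b^2 \text{ and } \gcd(a,b)=1\}$$ has cardinality $2^t$, and each of its elements has order $3$ in the multiplicative group $(\mathbb{Z}/f\mathbb{Z})^*$. Moreover, if $a,b\in\mathbb{Z}$ satisfy $f=a^2+ab+b^2$ and $\gcd(a,b)=1$, and $\delta\geq 1$ divides $f$, then there exist integers $a',b'$ such that $\delta=a'^2+a'b'+b'^2$, $\gcd(a',b')=1$, and $a/b=a'/b'$ in $(\mathbb{Z}/\delta\mathbb{Z})^*$.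
   Context: Here $a/b$ denotes the residue class of $a b^{ -1}$ modulo the relevant modulus (when $f=a^2+ab+b^2$ with $\gcd(a,b)=1$, both $a$ and $b$ are coprime to $f$). -}

module Defs where

open import Data.Nat as ℕ using (ℕ; _<_; _≤_)
open import Data.Integer as ℤ using (ℤ; +_; _*_; _+_; _-_; _^_)
open import Data.Integer.Divisibility using (_∣_)
open import Data.Integer.GCD using (gcd)
open import Data.Nat.Primality using (Prime)
open import Data.List using (List)
open import Data.List.Relation.Unary.Unique.Propositional using (Unique)
open import Data.List.Relation.Unary.All using (All)
open import Data.List.Membership.Propositional using (_∈_)
open import Data.Nat.Divisibility renaming (_∣_ to _ℕ∣_) using ()
open import Data.Product using (Σ; _×_)
open import Relation.Binary.PropositionalEquality using (_≡_)
open import Relation.Nullary using (¬_)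

_≡_[mod_] : ℤ → ℤ → ℕ → Set
x ≡ y [mod n ] = (+ n) ∣ (x - y)

N : ℤ → ℤ → ℤ
N a b = a * a + a * b + b * b

Rep : ℕ → ℤ → ℤ → Set
Rep f a b = (+ f ≡ N a b) × (gcd a b ≡ + 1)

-- r is the residue class a/b = a·b⁻¹ modulo n (b being a unit mod n):
-- r·b ≡ a (mod n)
IsQuot : ℕ → ℤ → ℤ → ℤ → Set
IsQuot n a b r = (r * b) ≡ a [mod n ]

InE : ℕ → ℕ → Set
InE f r = (r < f) × Σ ℤ (λ a → Σ ℤ (λ b → Rep f a b × IsQuot f a b (+ r)))

DistinctPrimeDivisors : ℕ → List ℕ → Set
DistinctPrimeDivisors f ps =
  Unique ps × All (λ p → Prime p × p ℕ∣ f) ps × (∀ p → Prime p → p ℕ∣ f → p ∈ ps)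

HasOrder3 : ℕ → ℤ → Set
HasOrder3 n r = ((r ^ 3) ≡ + 1 [mod n ]) × (∀ k → 1 ≤ k → k < 3 → ¬ ((r ^ k) ≡ + 1 [mod n ]))

{-# OPTIONS --safe #-}

-- If f = a² + ab + b² with gcd(a, b) = 1, then b is a unit modulo f and r = a/b satisfies
-- Φ₃(r) = r² + r + 1 ≡ N(a, b)/b² ≡ 0. Conversely every root r of Φ₃ modulo δ is such a quotient,
-- by descent: reduce r modulo δ so that Φ₃(r) = m δ with m < δ, represent m, and transport the
-- representation along the binary form of discriminant −3 linking m and δ. So E_f is the set of
-- roots of Φ₃ modulo f, and for δ ∣ f the root a/b of Φ₃ modulo δ is a quotient a′/b′ for δ.
-- Roots of Φ₃ are cube roots of unity, and r ≡ 1 would force f ∣ Φ₃(1) = 3.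
-- For the count: modulo a prime p = 3n + 1 not every unit x satisfies xⁿ ≡ 1 (Lagrange), and for
-- such x, Fermat makes xⁿ a cube root of unity other than 1, i.e. a root of Φ₃. As
-- (2r + 1)² = 4 Φ₃(r) − 3, the derivative 2r + 1 is a unit, so the root lifts to every p^e (Hensel)
-- and the roots modulo p^e are exactly r and −1 − r. The Chinese remainder theorem multiplies the
-- counts to 2^t.

module Submission where

open import Defs
open import Data.Nat using (ℕ; _<_; _≤_; _%_; _^_)
open import Data.Nat.Divisibility using (_∣_)
open import Data.Nat.Primality using (Prime)
open import Data.Integer using (ℤ; +_)
open import Data.List using (List; length)
open import Data.List.Relation.Unary.Unique.Propositional using (Unique)
open import Data.List.Membership.Propositional using (_∈_)
open import Data.Product using (Σ; _×_)
open import Function.Bundles using (_⇔_)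
open import Relation.Binary.PropositionalEquality using (_≡_)

open import Data.Fin as Fin using (Fin; toℕ; fromℕ; inject₁)
open import Data.Fin.Properties using (toℕ-fromℕ; toℕ-inject₁; toℕ<n)
open import Data.Integer as ℤ using (_*_; _+_; _-_; -_; 0ℤ; 1ℤ)
import Data.Integer.DivMod as ℤM
open import Data.Integer.Divisibility.Signed as ℤD using (divides) renaming (_∣_ to _∣ℤ_)
open import Data.Integer.GCD using (gcd; gcd[i,j]∣i; gcd[i,j]∣j)
import Data.Integer.Properties as ℤP
open import Data.Integer.Tactic.RingSolver using (solve-∀)
open import Data.List using ([]; _∷_; replicate; applyUpTo; cartesianProductWith; map; _++_)
open import Data.List.Membership.Propositional.Properties using (∈-cartesianProductWith⁺; ∈-cartesianProductWith⁻)
open import Data.List.Properties using (length-++; length-map; length-applyUpTo; length-replicate)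
open import Data.List.Relation.Unary.All as All using (All; []; _∷_; all?)
open import Data.List.Relation.Unary.All.Properties using (¬All⇒Any¬)
open import Data.List.Relation.Unary.AllPairs as AllPairs using ([]; _∷_)
open import Data.List.Relation.Unary.Any using (here; there)
open import Data.List.Relation.Unary.Any.Properties using (applyUpTo⁻)
open import Data.List.Relation.Unary.Unique.Setoid using () renaming (Unique to UniqueUpTo)
open import Data.List.Relation.Unary.Unique.Setoid.Properties using (applyUpTo⁺₁; cartesianProductWith⁺)
open import Data.Nat as ℕ using (zero; suc; z≤n; s≤s; NonZero; _!)
open import Data.Nat.Combinatorics using (_C_; nCn≡1; k![n∸k]!∣n!)
open import Data.Nat.Combinatorics.Specification using (nCk≡n!/k![n-k]!)
open import Data.Nat.Coprimality using (Coprime; coprime-Bézout; coprime-divisor; gcd≡1⇒coprime; coprime⇒gcd≡1)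
import Data.Nat.DivMod as ℕM
import Data.Nat.Divisibility as ℕD
open import Data.Nat.GCD using (module Bézout)
open import Data.Nat.Induction using (<-wellFounded)
open import Data.Nat.LCM using (lcm; lcm-least; gcd*lcm)
open import Data.Nat.ListAction using (product)
open import Data.Nat.Primality using (prime?; euclidsLemma; prime⇒irreducible; prime⇒nonTrivial; prime⇒nonZero)
open import Data.Nat.Primality.Factorisation using (factorise; PrimeFactorisation)
import Data.Nat.Properties as ℕP
open import Data.Product using (_,_; proj₁; proj₂)
open import Data.Sum as Sum using (_⊎_; inj₁; inj₂; [_,_]′)
open import Data.Vec.Functional using (init; tail)
open import Function using (_∘_)
open import Function.Bundles using (mk⇔; Equivalence)
import Function.Properties.Equivalence as ⇔
open import Induction.WellFounded using (Acc; acc)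
open import Relation.Binary.Bundles using (Setoid)
import Relation.Binary.Construct.On as On
open import Relation.Binary.PropositionalEquality using (_≢_; refl; sym; trans; cong; cong₂; subst; subst₂; module ≡-Reasoning)
import Relation.Binary.Reasoning.Setoid as ≈-Reasoning
open import Relation.Nullary using (¬_; contradiction; Dec; yes; no)
open import Relation.Nullary.Decidable using (from-yes)
import Relation.Nullary.Decidable as Dec
open import Algebra.Definitions.RawMonoid ℕ.+-0-rawMonoid using (sum)
open import Algebra.Definitions.RawSemiring ℕ.+-*-rawSemiring using () renaming (_^_ to _^′_; _×_ to _×′_)
open import Algebra.Properties.CommutativeSemiring.Binomial ℕP.+-*-commutativeSemiring using (theorem; binomialTerm)
open import Algebra.Properties.Monoid.Sum ℕP.+-0-monoid using (sum-init-last)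

-- Defs' congruence unfolds to ℕ-divisibility of an absolute value, from which Agda
-- cannot recover the two sides; the record wrapper makes them inferable.
infix 4 _≈_[mod_]
record _≈_[mod_] (x y : ℤ) (n : ℕ) : Set where
  constructor wrap
  field unwrap : x ≡ y [mod n ]
open _≈_[mod_] public

≈⇒∣ : ∀ {n x y} → x ≈ y [mod n ] → + n ∣ℤ (x - y)
≈⇒∣ x≈y = ℤD.∣ᵤ⇒∣ (unwrap x≈y)

∣⇒≈ : ∀ {n x y} → + n ∣ℤ (x - y) → x ≈ y [mod n ]
∣⇒≈ n∣x-y = wrap (ℤD.∣⇒∣ᵤ n∣x-y)

≈-by : ∀ {n x y} k → x - y ≡ k * + n → x ≈ y [mod n ]
≈-by k eq = ∣⇒≈ (divides k eq)

≡⇒≈ : ∀ {n x y} → x ≡ y → x ≈ y [mod n ]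
≡⇒≈ {x = x} refl = ≈-by 0ℤ (ℤP.+-inverseʳ x)

≈-refl : ∀ {n x} → x ≈ x [mod n ]
≈-refl = ≡⇒≈ refl

≈-sym : ∀ {n x y} → x ≈ y [mod n ] → y ≈ x [mod n ]
≈-sym {n} {x} {y} x≈y = ∣⇒≈ (subst (+ n ∣ℤ_) (negate x y) (ℤD.∣m⇒∣-m (≈⇒∣ x≈y)))
  where
  negate : ∀ x y → - (x - y) ≡ y - x
  negate = solve-∀

≈-trans : ∀ {n x y z} → x ≈ y [mod n ] → y ≈ z [mod n ] → x ≈ z [mod n ]
≈-trans {n} {x} {y} {z} x≈y y≈z =
  ∣⇒≈ (subst (+ n ∣ℤ_) (telescope x y z) (ℤD.∣m∣n⇒∣m+n (≈⇒∣ x≈y) (≈⇒∣ y≈z)))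
  where
  telescope : ∀ x y z → (x - y) + (y - z) ≡ x - z
  telescope = solve-∀

≈-+ : ∀ {n x x′ y y′} → x ≈ x′ [mod n ] → y ≈ y′ [mod n ] → x + y ≈ x′ + y′ [mod n ]
≈-+ {n} {x} {x′} {y} {y′} x≈x′ y≈y′ =
  ∣⇒≈ (subst (+ n ∣ℤ_) (regroup x x′ y y′) (ℤD.∣m∣n⇒∣m+n (≈⇒∣ x≈x′) (≈⇒∣ y≈y′)))
  where
  regroup : ∀ x x′ y y′ → (x - x′) + (y - y′) ≡ (x + y) - (x′ + y′)
  regroup = solve-∀

≈-* : ∀ {n x x′ y y′} → x ≈ x′ [mod n ] → y ≈ y′ [mod n ] → x * y ≈ x′ * y′ [mod n ]
≈-* {n} {x} {x′} {y} {y′} x≈x′ y≈y′ =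
  ∣⇒≈ (subst (+ n ∣ℤ_) (regroup x x′ y y′)
    (ℤD.∣m∣n⇒∣m+n (ℤD.∣n⇒∣m*n x (≈⇒∣ y≈y′)) (ℤD.∣m⇒∣m*n y′ (≈⇒∣ x≈x′))))
  where
  regroup : ∀ x x′ y y′ → x * (y - y′) + (x - x′) * y′ ≡ x * y - x′ * y′
  regroup = solve-∀

≈-*ˡ : ∀ {n} x {y y′} → y ≈ y′ [mod n ] → x * y ≈ x * y′ [mod n ]
≈-*ˡ x = ≈-* (≈-refl {x = x})

≈-*ʳ : ∀ {n} x {y y′} → y ≈ y′ [mod n ] → y * x ≈ y′ * x [mod n ]
≈-*ʳ x y≈y′ = ≈-* y≈y′ (≈-refl {x = x})

≈-setoid : ℕ → Setoid _ _
≈-setoid n = record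
  { Carrier = ℤ
  ; _≈_ = _≈_[mod n ]
  ; isEquivalence = record { refl = ≈-refl ; sym = ≈-sym ; trans = ≈-trans }
  }

≈-∣ : ∀ {d n x y} → d ∣ n → x ≈ y [mod n ] → x ≈ y [mod d ]
≈-∣ d∣n x≈y = wrap (ℕD.∣-trans d∣n (unwrap x≈y))

*n≈0 : ∀ {n} k → k * + n ≈ 0ℤ [mod n ]
*n≈0 {n} k = ≈-by k (ℤP.+-identityʳ (k * + n))

+-multiple≈ : ∀ {n} x k → x + + n * k ≈ x [mod n ]
+-multiple≈ {n} x k = ≈-by k (cancel x (+ n) k)
  where
  cancel : ∀ x n k → x + n * k - x ≡ k * n
  cancel = solve-∀

≈⇒+multiple : ∀ {n x y} → x ≈ y [mod n ] → Σ ℤ λ k → y ≡ x + + n * k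
≈⇒+multiple {n} {x} {y} x≈y = - j , (begin
  y                    ≡⟨ cancel x y ⟩
  x - (x - y)          ≡⟨ cong (λ t → x - t) x-y≡jn ⟩
  x - j * + n          ≡⟨ flip x j (+ n) ⟩
  x + + n * - j        ∎)
  where
  open ≡-Reasoning
  open ℤD._∣_ (≈⇒∣ x≈y) renaming (quotient to j; equality to x-y≡jn)
  cancel : ∀ x y → y ≡ x - (x - y)
  cancel = solve-∀
  flip : ∀ x j n → x - j * n ≡ x + n * - j
  flip = solve-∀

%ℕ≈ : ∀ x n .{{_ : NonZero n}} → + (x ℤM.%ℕ n) ≈ x [mod n ]
%ℕ≈ x n = ≈-sym (≈-by (x ℤM./ℕ n) (begin
  x - + r                          ≡⟨ cong (_- + r) (ℤM.a≡a%ℕn+[a/ℕn]*n x n) ⟩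
  + r + x ℤM./ℕ n * + n - + r      ≡⟨ cancel (+ r) (x ℤM./ℕ n * + n) ⟩
  x ℤM./ℕ n * + n                  ∎))
  where
  open ≡-Reasoning
  r = x ℤM.%ℕ n
  cancel : ∀ r q → r + q - r ≡ q
  cancel = solve-∀

≤∧≈⇒≡ : ∀ {n a b} → a ≤ b → b < n → + b ≈ + a [mod n ] → b ≡ a
≤∧≈⇒≡ {n} {a} {b} a≤b b<n b≈a = ℕP.≤-antisym (ℕP.m∸n≡0⇒m≤n b∸a≡0) a≤b
  where
  n∣b∸a : n ∣ b ℕ.∸ a
  n∣b∸a = subst (n ∣_) (cong ℤ.∣_∣ (trans (ℤP.m-n≡m⊖n b a) (ℤP.⊖-≥ a≤b))) (unwrap b≈a)
  b∸a≡0 : b ℕ.∸ a ≡ 0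
  b∸a≡0 with b ℕ.∸ a in eq
  ... | zero  = refl
  ... | suc _ = contradiction (ℕD.∣⇒≤ (subst (n ∣_) eq n∣b∸a))
                  (ℕP.<⇒≱ (subst (_< n) eq (ℕP.≤-<-trans (ℕP.m∸n≤m b a) b<n)))

≈⇒≡ : ∀ {n a b} → a < n → b < n → + a ≈ + b [mod n ] → a ≡ b
≈⇒≡ {a = a} {b} a<n b<n a≈b with ℕP.≤-total a b
... | inj₁ a≤b = sym (≤∧≈⇒≡ a≤b b<n (≈-sym a≈b))
... | inj₂ b≤a = ≤∧≈⇒≡ b≤a a<n a≈b

Φ₃ : ℤ → ℤ
Φ₃ x = x * x + x + 1ℤ

Root : ℕ → ℤ → Set
Root n x = Φ₃ x ≈ 0ℤ [mod n ]

N-cong : ∀ {n x x′ y y′} → x ≈ x′ [mod n ] → y ≈ y′ [mod n ] → N x y ≈ N x′ y′ [mod n ]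
N-cong x≈x′ y≈y′ = ≈-+ (≈-+ (≈-* x≈x′ x≈x′) (≈-* x≈x′ y≈y′)) (≈-* y≈y′ y≈y′)

Φ₃-cong : ∀ {n x y} → x ≈ y [mod n ] → Φ₃ x ≈ Φ₃ y [mod n ]
Φ₃-cong x≈y = ≈-+ (≈-+ (≈-* x≈y x≈y) x≈y) ≈-refl

Root-cong : ∀ {n x y} → x ≈ y [mod n ] → Root n x → Root n y
Root-cong x≈y root = ≈-trans (≈-sym (Φ₃-cong x≈y)) root

Φ₃-pos : ∀ r → Φ₃ (+ r) ≡ + suc (r ℕ.* r ℕ.+ r)
Φ₃-pos r = begin
  + r * + r + + r + 1ℤ        ≡⟨ cong (λ t → t + + r + 1ℤ) (ℤP.pos-* r r) ⟨
  + (r ℕ.* r) + + r + 1ℤ      ≡⟨ cong (_+ 1ℤ) (ℤP.pos-+ (r ℕ.* r) r) ⟨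
  + (r ℕ.* r ℕ.+ r) + 1ℤ      ≡⟨ ℤP.+-comm (+ (r ℕ.* r ℕ.+ r)) 1ℤ ⟩
  + suc (r ℕ.* r ℕ.+ r)       ∎
  where open ≡-Reasoning

Φ₃-bound : ∀ {r δ} → r < δ → 1 < δ → suc (r ℕ.* r ℕ.+ r) < δ ℕ.* δ
Φ₃-bound {r} {δ} r<δ 1<δ = begin-strict
  suc (r ℕ.* r ℕ.+ r)  ≡⟨ cong suc (trans (ℕP.+-comm (r ℕ.* r) r) (sym (ℕP.*-suc r r))) ⟩
  suc (r ℕ.* suc r)    ≤⟨ s≤s (ℕP.*-monoʳ-≤ r r<δ) ⟩
  suc (r ℕ.* δ)        <⟨ ℕP.+-monoˡ-< (r ℕ.* δ) 1<δ ⟩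
  suc r ℕ.* δ          ≤⟨ ℕP.*-monoˡ-≤ δ r<δ ⟩
  δ ℕ.* δ              ∎
  where open ℕP.≤-Reasoning

-- Roots of Φ₃ versus representations by the norm form

bézout-cast : ∀ a b c d → 1 ℕ.+ c ℕ.* d ≡ a ℕ.* b → + a * + b - + c * + d ≡ 1ℤ
bézout-cast a b c d eq = begin
  + a * + b - + c * + d            ≡⟨ cong₂ _-_ (ℤP.pos-* a b) (ℤP.pos-* c d) ⟨
  + (a ℕ.* b) - + (c ℕ.* d)        ≡⟨ cong (λ t → + t - + (c ℕ.* d)) eq ⟨
  + (1 ℕ.+ c ℕ.* d) - + (c ℕ.* d)  ≡⟨ cong (_- + (c ℕ.* d)) (ℤP.pos-+ 1 (c ℕ.* d)) ⟩
  1ℤ + + (c ℕ.* d) - + (c ℕ.* d)   ≡⟨ cancel 1ℤ (+ (c ℕ.* d)) ⟩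
  1ℤ                               ∎
  where
  open ≡-Reasoning
  cancel : ∀ a b → a + b - b ≡ a
  cancel = solve-∀

coprime⇒bézout : ∀ {m n} → Coprime m n → Σ ℤ λ u → Σ ℤ λ v → u * + m + v * + n ≡ 1ℤ
coprime⇒bézout {m} {n} c with coprime-Bézout c
... | Bézout.+- x y eq = + x , - + y , trans (minus (+ x) (+ m) (+ y) (+ n)) (bézout-cast x m y n eq)
  where
  minus : ∀ a b c d → a * b + - c * d ≡ a * b - c * d
  minus = solve-∀
... | Bézout.-+ x y eq = - + x , + y , trans (minus (+ x) (+ m) (+ y) (+ n)) (bézout-cast y n x m eq)
  where
  minus : ∀ a b c d → - a * b + c * d ≡ c * d - a * b
  minus = solve-∀

gcd≡1⇒bézout : ∀ a b → gcd a b ≡ + 1 → Σ ℤ λ u → Σ ℤ λ v → u * a + v * b ≡ 1ℤ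
gcd≡1⇒bézout a b gcd≡1 =
  let u , v , eq = coprime⇒bézout {ℤ.∣ a ∣} {ℤ.∣ b ∣} (gcd≡1⇒coprime (ℤP.+-injective gcd≡1)) in
  u * σ , v * τ , trans (reassoc u σ a v τ b) (trans (cong₂ (λ s t → u * s + v * t) (sym |a|≡σa) (sym |b|≡τb)) eq)
  where
  open ℤD._∣_ (ℤD.m∣∣m∣ {a}) renaming (quotient to σ; equality to |a|≡σa)
  open ℤD._∣_ (ℤD.m∣∣m∣ {b}) renaming (quotient to τ; equality to |b|≡τb)
  reassoc : ∀ u σ a v τ b → u * σ * a + v * τ * b ≡ u * (σ * a) + v * (τ * b)
  reassoc = solve-∀

bézout⇒gcd≡1 : ∀ {x y} u v → u * x + v * y ≡ 1ℤ → gcd x y ≡ + 1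
bézout⇒gcd≡1 {x} {y} u v eq = cong +_ (ℕD.∣1⇒≡1 (ℤD.∣⇒∣ᵤ gcd∣1))
  where
  gcd∣1 : gcd x y ∣ℤ 1ℤ
  gcd∣1 = subst (gcd x y ∣ℤ_) eq
    (ℤD.∣m∣n⇒∣m+n (ℤD.∣n⇒∣m*n u (ℤD.∣ᵤ⇒∣ (gcd[i,j]∣i x y))) (ℤD.∣n⇒∣m*n v (ℤD.∣ᵤ⇒∣ (gcd[i,j]∣j x y))))

-- Squaring the Bézout relation u a + v b = 1 and subtracting u²·N(a, b) leaves a multiple of b.
bézout⇒inverse : ∀ {f a b} u v → u * a + v * b ≡ 1ℤ → + f ≡ N a b → Σ ℤ λ s → s * b ≈ 1ℤ [mod f ]
bézout⇒inverse {f} {a} {b} u v eq f≡N = s , ≈-by (- (u * u)) (begin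
  s * b - 1ℤ                                   ≡⟨ cong (λ t → s * b - t) (trans (sym (ℤP.*-identityʳ 1ℤ)) (cong₂ _*_ (sym eq) (sym eq))) ⟩
  s * b - (u * a + v * b) * (u * a + v * b)    ≡⟨ expand u v a b ⟩
  - (u * u) * N a b                            ≡⟨ cong (- (u * u) *_) f≡N ⟨
  - (u * u) * + f                              ∎)
  where
  open ≡-Reasoning
  s = u * a * (v + v - u) + (v * v - u * u) * b
  expand : ∀ u v a b → (u * a * (v + v - u) + (v * v - u * u) * b) * b - (u * a + v * b) * (u * a + v * b)
                     ≡ - (u * u) * (a * a + a * b + b * b)
  expand = solve-∀

Rep⇒inverse : ∀ {f a b} → Rep f a b → Σ ℤ λ s → s * b ≈ 1ℤ [mod f ]
Rep⇒inverse {a = a} {b} (f≡N , gcd≡1) =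
  let u , v , eq = gcd≡1⇒bézout a b gcd≡1 in bézout⇒inverse u v eq f≡N

quotient⇒root : ∀ {f a b r} → Rep f a b → IsQuot f a b r → Root f r
quotient⇒root {f} {a} {b} {r} rep rb≡a = begin
  Φ₃ r                        ≡⟨ unfold r ⟩
  Φ₃ r * (1ℤ * 1ℤ)            ≈⟨ ≈-*ˡ (Φ₃ r) (≈-* sb≈1 sb≈1) ⟨
  Φ₃ r * ((s * b) * (s * b))  ≡⟨ homogenise s b r ⟩
  s * s * N (r * b) b         ≈⟨ ≈-*ˡ (s * s) (N-cong (wrap {r * b} {a} rb≡a) ≈-refl) ⟩
  s * s * N a b               ≡⟨ cong (s * s *_) (proj₁ rep) ⟨
  s * s * + f                 ≈⟨ *n≈0 (s * s) ⟩
  0ℤ                          ∎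
  where
  open ≈-Reasoning (≈-setoid f)
  s = proj₁ (Rep⇒inverse {f} {a} {b} rep)
  sb≈1 = proj₂ (Rep⇒inverse {f} {a} {b} rep)
  unfold : ∀ r → r * r + r + 1ℤ ≡ (r * r + r + 1ℤ) * (1ℤ * 1ℤ)
  unfold = solve-∀
  homogenise : ∀ s b r → (r * r + r + 1ℤ) * ((s * b) * (s * b))
                       ≡ s * s * ((r * b) * (r * b) + (r * b) * b + b * b)
  homogenise = solve-∀

-- Descent

form : ℤ → ℤ → ℤ → ℤ → ℤ → ℤ
form M B D k y = M * k * k + B * k * y + D * y * y

-- Φ₃ R = M·D says that the form [M, 2R+1, D] has discriminant −3; the substitution
-- x = R y + M k carries the norm form to M times it.
N-factor : ∀ R M D k y → Φ₃ R ≡ M * D → N (R * y + M * k) y ≡ M * form M (R + R + 1ℤ) D k y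
N-factor R M D k y ΦR≡MD = begin
  N (R * y + M * k) y                                          ≡⟨ expand R M k y ⟩
  Φ₃ R * y * y + M * ((R + R + 1ℤ) * k * y + M * k * k)        ≡⟨ cong (λ t → t * y * y + M * ((R + R + 1ℤ) * k * y + M * k * k)) ΦR≡MD ⟩
  M * D * y * y + M * ((R + R + 1ℤ) * k * y + M * k * k)       ≡⟨ collect R M D k y ⟩
  M * form M (R + R + 1ℤ) D k y                                ∎
  where
  open ≡-Reasoning
  expand : ∀ R M k y → (R * y + M * k) * (R * y + M * k) + (R * y + M * k) * y + y * y
                     ≡ (R * R + R + 1ℤ) * y * y + M * ((R + R + 1ℤ) * k * y + M * k * k)
  expand = solve-∀
  collect : ∀ R M D k y → M * D * y * y + M * ((R + R + 1ℤ) * k * y + M * k * k)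
                        ≡ M * (M * k * k + (R + R + 1ℤ) * k * y + D * y * y)
  collect = solve-∀

form≡1 : ∀ R M D k y .{{_ : ℤ.NonZero M}} → Φ₃ R ≡ M * D → N (R * y + M * k) y ≡ M →
         form M (R + R + 1ℤ) D k y ≡ 1ℤ
form≡1 R M D k y ΦR≡MD N≡M = ℤP.*-cancelˡ-≡ M _ 1ℤ
  (trans (sym (N-factor R M D k y ΦR≡MD)) (trans N≡M (sym (ℤP.*-identityʳ M))))

Φ₃≡*⇒Root : ∀ {n} x k → Φ₃ x ≡ k * + n → Root n x
Φ₃≡*⇒Root x k eq = ≈-by k (trans (ℤP.+-identityʳ (Φ₃ x)) eq)

Root⇒∣ : ∀ {n r} → Root n (+ r) → n ∣ suc (r ℕ.* r ℕ.+ r)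
Root⇒∣ {n} {r} root = subst (n ∣_) (cong ℤ.∣_∣ (trans (ℤP.+-identityʳ (Φ₃ (+ r))) (Φ₃-pos r))) (unwrap root)

descent-step : ∀ {m δ} R .{{_ : NonZero m}} → Φ₃ R ≡ + m * + δ →
               (Σ ℤ λ x → Σ ℤ λ y → + m ≡ N x y × IsQuot m x y R) →
               Σ ℤ λ x → Σ ℤ λ y → + δ ≡ N x y × IsQuot δ x y R
descent-step {m} {δ} R ΦR≡MD (x′ , y′ , m≡N , quot′) =
  R * k + D * y′ , k , sym N≡D , unwrap (≈-sym (+-multiple≈ (R * k) y′))
  where
  open ≡-Reasoning
  M = + m
  D = + δ
  shift = ≈⇒+multiple (wrap {R * y′} {x′} {m} quot′)
  k = proj₁ shift
  form≡1′ : form M (R + R + 1ℤ) D k y′ ≡ 1ℤ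
  form≡1′ = form≡1 R M D k y′ ΦR≡MD (trans (cong (λ t → N t y′) (sym (proj₂ shift))) (sym m≡N))
  swap : ∀ D B M y k → D * y * y + B * y * k + M * k * k ≡ M * k * k + B * k * y + D * y * y
  swap = solve-∀
  N≡D : N (R * k + D * y′) k ≡ D
  N≡D = begin
    N (R * k + D * y′) k                ≡⟨ N-factor R D M y′ k (trans ΦR≡MD (ℤP.*-comm M D)) ⟩
    D * form D (R + R + 1ℤ) M y′ k      ≡⟨ cong (D *_) (swap D (R + R + 1ℤ) M y′ k) ⟩
    D * form M (R + R + 1ℤ) D k y′      ≡⟨ cong (D *_) form≡1′ ⟩
    D * 1ℤ                              ≡⟨ ℤP.*-identityʳ D ⟩
    D                                   ∎

descent : ∀ δ → Acc ℕ._<_ δ → .{{_ : NonZero δ}} → ∀ r → Root δ r →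
          Σ ℤ λ x → Σ ℤ λ y → + δ ≡ N x y × IsQuot δ x y r
descent 1 _ r _ = 1ℤ , 0ℤ , refl , ℕD.1∣ _
descent δ@(suc (suc _)) (acc smaller) r root = reduce (Root⇒∣ {δ} {r₀} (Root-cong {y = + r₀} (≈-sym (%ℕ≈ r δ)) root))
  where
  r₀ = r ℤM.%ℕ δ
  reduce : δ ∣ suc (r₀ ℕ.* r₀ ℕ.+ r₀) → Σ ℤ λ x → Σ ℤ λ y → + δ ≡ N x y × IsQuot δ x y r
  reduce (ℕD.divides (suc m′) Φr₀≡mδ) =
    let x , y , δ≡N , quot = descent-step (+ r₀) ΦR≡MD (descent m (smaller m<δ) (+ r₀) root-m)
    in x , y , δ≡N , unwrap (≈-trans (≈-*ʳ y (≈-sym (%ℕ≈ r δ))) (wrap {+ r₀ * y} {x} quot))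
    where
    m = suc m′
    ΦR≡MD : Φ₃ (+ r₀) ≡ + m * + δ
    ΦR≡MD = trans (Φ₃-pos r₀) (trans (cong +_ Φr₀≡mδ) (ℤP.pos-* m δ))
    root-m : Root m (+ r₀)
    root-m = Φ₃≡*⇒Root (+ r₀) (+ δ) (trans ΦR≡MD (ℤP.*-comm (+ m) (+ δ)))
    m<δ : m < δ
    m<δ = ℕP.*-cancelʳ-< δ m δ (subst (_< δ ℕ.* δ) Φr₀≡mδ (Φ₃-bound (ℤM.n%ℕd<d r δ) (s≤s (s≤s z≤n))))

-- The Bézout combination k x + (q y + k (r + 1)) y is the form [δ, 2r + 1, q] at (k, y), which is 1.
root⇒coprime : ∀ {δ x y r} .{{_ : NonZero δ}} → Root δ r → + δ ≡ N x y → IsQuot δ x y r → gcd x y ≡ + 1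
root⇒coprime {δ} {x} {y} {r} root δ≡N quot = bézout⇒gcd≡1 k (q * y + k * (r + 1ℤ)) (begin
  k * x + (q * y + k * (r + 1ℤ)) * y                  ≡⟨ cong (λ t → k * t + (q * y + k * (r + 1ℤ)) * y) x≡ ⟩
  k * (r * y + D * k) + (q * y + k * (r + 1ℤ)) * y    ≡⟨ regroup r D q k y ⟩
  form D (r + r + 1ℤ) q k y                           ≡⟨ form≡1 r D q k y Φr≡Dq (trans (cong (λ t → N t y) (sym x≡)) (sym δ≡N)) ⟩
  1ℤ                                                  ∎)
  where
  open ≡-Reasoning
  D = + δ
  Φ-shift = ≈⇒+multiple (≈-sym root)
  q = proj₁ Φ-shift
  Φr≡Dq : Φ₃ r ≡ D * q
  Φr≡Dq = trans (proj₂ Φ-shift) (ℤP.+-identityˡ (D * q))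
  x-shift = ≈⇒+multiple (wrap {r * y} {x} {δ} quot)
  k = proj₁ x-shift
  x≡ : x ≡ r * y + D * k
  x≡ = proj₂ x-shift
  regroup : ∀ r D q k y → k * (r * y + D * k) + (q * y + k * (r + 1ℤ)) * y ≡ D * k * k + (r + r + 1ℤ) * k * y + q * y * y
  regroup = solve-∀

root⇒Rep : ∀ {δ r} .{{_ : NonZero δ}} → Root δ r → Σ ℤ λ x → Σ ℤ λ y → Rep δ x y × IsQuot δ x y r
root⇒Rep {δ} {r} root =
  let x , y , δ≡N , quot = descent δ (<-wellFounded δ) r root
  in x , y , (δ≡N , root⇒coprime {δ} {x} {y} {r} root δ≡N quot) , quot

OneModThreePrimeFactors : ℕ → Set
OneModThreePrimeFactors f = ∀ p → Prime p → p ∣ f → p % 3 ≡ 1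

prime[3] : Prime 3
prime[3] = from-yes (prime? 3)

∣3⇒≡3 : ∀ {n} → 1 < n → n ∣ 3 → n ≡ 3
∣3⇒≡3 1<n n∣3 with prime⇒irreducible prime[3] n∣3
... | inj₁ n≡1 = contradiction n≡1 (ℕP.>⇒≢ 1<n)
... | inj₂ n≡3 = n≡3

OneModThreePrimeFactors⇒∤3 : ∀ {n} → 1 < n → OneModThreePrimeFactors n → ¬ n ∣ 3
OneModThreePrimeFactors⇒∤3 1<n one-mod-3 n∣3 with ∣3⇒≡3 1<n n∣3
... | refl = contradiction (one-mod-3 3 prime[3] ℕD.∣-refl) λ ()

root⇒order3 : ∀ {n r} → ¬ n ∣ 3 → Root n r → HasOrder3 n r
root⇒order3 {n} {r} n∤3 root = unwrap r³≈1 , order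
  where
  open ≈-Reasoning (≈-setoid n)
  r³≈1 : r ℤ.^ 3 ≈ 1ℤ [mod n ]
  r³≈1 = begin
    r * (r * (r * 1ℤ))        ≡⟨ cube r ⟩
    (r - 1ℤ) * Φ₃ r + 1ℤ      ≈⟨ ≈-+ (≈-*ˡ (r - 1ℤ) root) ≈-refl ⟩
    (r - 1ℤ) * 0ℤ + 1ℤ        ≡⟨ cong (_+ 1ℤ) (ℤP.*-zeroʳ (r - 1ℤ)) ⟩
    1ℤ                        ∎
    where
    cube : ∀ r → r * (r * (r * 1ℤ)) ≡ (r - 1ℤ) * (r * r + r + 1ℤ) + 1ℤ
    cube = solve-∀
  r≉1 : ¬ (r ℤ.^ 1 ≈ 1ℤ [mod n ])
  r≉1 r≈1 = n∤3 (unwrap (begin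
    Φ₃ 1ℤ          ≈⟨ Φ₃-cong r≈1 ⟨
    Φ₃ (r * 1ℤ)    ≡⟨ cong Φ₃ (ℤP.*-identityʳ r) ⟩
    Φ₃ r           ≈⟨ root ⟩
    0ℤ             ∎))
  order : ∀ k → 1 ≤ k → k < 3 → ¬ ((r ℤ.^ k) ≡ + 1 [mod n ])
  order 1 _ _ r≡1 = r≉1 (wrap r≡1)
  order 2 _ _ r²≡1 = r≉1 (≈-trans (≈-*ˡ r (≈-sym (wrap {r ℤ.^ 2} {1ℤ} r²≡1))) r³≈1)
  order (suc (suc (suc _))) _ (s≤s (s≤s (s≤s ())))

Rep⇒quotient : ∀ {f a b} → Rep f a b → Σ ℤ λ r → IsQuot f a b r
Rep⇒quotient {f} {a} {b} rep = a * s , unwrap (begin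
  a * s * b       ≡⟨ ℤP.*-assoc a s b ⟩
  a * (s * b)     ≈⟨ ≈-*ˡ a sb≈1 ⟩
  a * 1ℤ          ≡⟨ ℤP.*-identityʳ a ⟩
  a               ∎)
  where
  open ≈-Reasoning (≈-setoid f)
  s = proj₁ (Rep⇒inverse {f} {a} {b} rep)
  sb≈1 = proj₂ (Rep⇒inverse {f} {a} {b} rep)

Rep⇒divisor-Rep : ∀ {f a b δ} .{{_ : NonZero δ}} → Rep f a b → δ ∣ f →
  Σ ℤ (λ a′ → Σ ℤ (λ b′ → Rep δ a′ b′ × Σ ℤ (λ r → IsQuot δ a b r × IsQuot δ a′ b′ r)))
Rep⇒divisor-Rep {f} {a} {b} {δ} rep δ∣f =
  let r , quot = Rep⇒quotient {f} {a} {b} rep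
      a′ , b′ , rep′ , quot′ = root⇒Rep {δ} {r} (≈-∣ δ∣f (quotient⇒root {f} {a} {b} {r} rep quot))
  in a′ , b′ , rep′ , r , ℕD.∣-trans δ∣f quot , quot′

-- Fermat's little theorem

prime>1 : ∀ {p} → Prime p → 1 < p
prime>1 {p} pp = ℕ.nonTrivial⇒n>1 p {{prime⇒nonTrivial pp}}

prime∣!⇒≤ : ∀ {p} → Prime p → ∀ m → p ∣ m ! → p ≤ m
prime∣!⇒≤ pp zero p∣1 = contradiction (ℕD.∣1⇒≡1 p∣1) (ℕP.>⇒≢ (prime>1 pp))
prime∣!⇒≤ pp (suc m) p∣[1+m]! =
  [ ℕD.∣⇒≤ , (λ p∣m! → ℕP.m≤n⇒m≤1+n (prime∣!⇒≤ pp m p∣m!)) ]′ (euclidsLemma (suc m) (m !) pp p∣[1+m]!)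

nCk*k!*[n∸k]!≡n! : ∀ {n k} → k ≤ n → (n C k) ℕ.* (k ! ℕ.* (n ℕ.∸ k) !) ≡ n !
nCk*k!*[n∸k]!≡n! {n} {k} k≤n =
  trans (cong (ℕ._* (k ! ℕ.* (n ℕ.∸ k) !)) (nCk≡n!/k![n-k]! k≤n)) (ℕM.m/n*n≡m (k![n∸k]!∣n! k≤n))
  where instance _ = k ℕP.!* (n ℕ.∸ k) !≢0

prime∣pCk : ∀ {p k} → Prime p → 0 < k → k < p → p ∣ p C k
prime∣pCk {p@(suc p′)} {k} pp 0<k k<p =
  [ (λ p∣pCk → p∣pCk) , (λ p∣k!*[p∸k]! → [ k!-case , [p∸k]!-case ]′ (euclidsLemma _ _ pp p∣k!*[p∸k]!)) ]′
  (euclidsLemma (p C k) _ pp (subst (p ∣_) (sym (nCk*k!*[n∸k]!≡n! (ℕP.<⇒≤ k<p))) (ℕD.m∣m*n (p′ !))))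
  where
  k!-case : p ∣ k ! → p ∣ p C k
  k!-case p∣k! = contradiction (prime∣!⇒≤ pp k p∣k!) (ℕP.<⇒≱ k<p)
  [p∸k]!-case : p ∣ (p ℕ.∸ k) ! → p ∣ p C k
  [p∸k]!-case p∣[p∸k]! = contradiction (prime∣!⇒≤ pp _ p∣[p∸k]!) (ℕP.<⇒≱ (ℕP.∸-monoʳ-< 0<k (ℕP.<⇒≤ k<p)))

^′≡^ : ∀ x n → x ^′ n ≡ x ^ n
^′≡^ x zero = refl
^′≡^ x (suc n) = cong (x ℕ.*_) (^′≡^ x n)

×′≡* : ∀ n x → n ×′ x ≡ n ℕ.* x
×′≡* zero x = refl
×′≡* (suc n) x = cong (x ℕ.+_) (×′≡* n x)

∣-sum : ∀ {d n} (t : Fin n → ℕ) → (∀ i → d ∣ t i) → d ∣ sum t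
∣-sum {d} {zero} t _ = d ℕD.∣0
∣-sum {n = suc n} t d∣t = ℕD.∣m∣n⇒∣m+n (d∣t Fin.zero) (∣-sum (t ∘ Fin.suc) (d∣t ∘ Fin.suc))

freshman's-dream : ∀ {p} → Prime p → ∀ x → Σ ℕ λ M → p ∣ M × suc x ^ p ≡ x ^ p ℕ.+ M ℕ.+ 1
freshman's-dream {p@(suc p′)} pp x = M , ∣-sum (init (tail t)) p∣middle , (begin
  suc x ^ p                                   ≡⟨ ^′≡^ (suc x) p ⟨
  suc x ^′ p                                    ≡⟨ theorem p 1 x ⟩
  t Fin.zero ℕ.+ sum (tail t)                   ≡⟨ cong (t Fin.zero ℕ.+_) (sum-init-last (tail t)) ⟩
  t Fin.zero ℕ.+ (M ℕ.+ t (fromℕ p))            ≡⟨ ℕP.+-assoc (t Fin.zero) M _ ⟨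
  t Fin.zero ℕ.+ M ℕ.+ t (fromℕ p)              ≡⟨ cong₂ (λ a b → a ℕ.+ M ℕ.+ b) (t≡term Fin.zero) (trans (t≡term (fromℕ p)) last≡1) ⟩
  term 0 ℕ.+ M ℕ.+ 1                            ≡⟨ cong (λ a → a ℕ.+ M ℕ.+ 1) (ℕP.*-identityˡ (x ^ p)) ⟩
  x ^ p ℕ.+ M ℕ.+ 1                           ∎)
  where
  open ≡-Reasoning
  t = binomialTerm 1 x p
  M = sum (init (tail t))
  term : ℕ → ℕ
  term k = (p C k) ℕ.* x ^ (p ℕ.∸ k)
  t≡term : ∀ i → t i ≡ term (toℕ i)
  t≡term i = begin
    t i                                                      ≡⟨ ×′≡* (p C k) _ ⟩
    (p C k) ℕ.* (1 ^′ k ℕ.* x ^′ (p ℕ.∸ k))                  ≡⟨ cong (λ a → (p C k) ℕ.* (a ℕ.* x ^′ (p ℕ.∸ k))) (trans (^′≡^ 1 k) (ℕP.^-zeroˡ k)) ⟩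
    (p C k) ℕ.* (1 ℕ.* x ^′ (p ℕ.∸ k))                       ≡⟨ cong ((p C k) ℕ.*_) (trans (ℕP.*-identityˡ _) (^′≡^ x (p ℕ.∸ k))) ⟩
    term k                                                   ∎
    where k = toℕ i
  last≡1 : term (toℕ (fromℕ p)) ≡ 1
  last≡1 = trans (cong term (toℕ-fromℕ p)) (cong₂ (λ a b → a ℕ.* x ^ b) (nCn≡1 p) (ℕP.n∸n≡0 p))
  p∣middle : ∀ i → p ∣ init (tail t) i
  p∣middle i = subst (p ∣_) (sym (t≡term (Fin.suc (inject₁ i))))
    (ℕD.∣m⇒∣m*n _ (prime∣pCk pp (s≤s z≤n) (s≤s (subst (_< p′) (sym (toℕ-inject₁ i)) (toℕ<n i)))))

pos-^ : ∀ x n → + (x ^ n) ≡ (+ x) ℤ.^ n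
pos-^ x zero = refl
pos-^ x (suc n) = trans (ℤP.pos-* x (x ^ n)) (cong (+ x *_) (pos-^ x n))

fermat : ∀ {p} → Prime p → ∀ x → (+ x) ℤ.^ p ≈ + x [mod p ]
fermat {p@(suc _)} pp zero = ≈-refl
fermat {p} pp (suc x) = begin
  (+ suc x) ℤ.^ p                        ≡⟨ pos-^ (suc x) p ⟨
  + (suc x ^ p)                        ≡⟨ cong +_ x^p+M+1 ⟩
  + (x ^ p ℕ.+ q ℕ.* p ℕ.+ 1)          ≡⟨ ℤP.pos-+ (x ^ p ℕ.+ q ℕ.* p) 1 ⟩
  + (x ^ p ℕ.+ q ℕ.* p) + 1ℤ           ≡⟨ cong (_+ 1ℤ) (ℤP.pos-+ (x ^ p) (q ℕ.* p)) ⟩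
  + (x ^ p) + + (q ℕ.* p) + 1ℤ         ≡⟨ cong (λ t → + (x ^ p) + t + 1ℤ) (ℤP.pos-* q p) ⟩
  + (x ^ p) + + q * + p + 1ℤ           ≡⟨ shuffle (+ (x ^ p)) (+ q) (+ p) ⟩
  + (x ^ p) + 1ℤ + + p * + q           ≈⟨ +-multiple≈ (+ (x ^ p) + 1ℤ) (+ q) ⟩
  + (x ^ p) + 1ℤ                       ≈⟨ ≈-+ (≈-trans (≡⇒≈ (pos-^ x p)) (fermat pp x)) (≈-refl {x = 1ℤ}) ⟩
  + x + 1ℤ                               ≡⟨ ℤP.+-comm (+ x) 1ℤ ⟩
  + suc x                                ∎
  where
  open ≈-Reasoning (≈-setoid p)
  dream = freshman's-dream pp x
  q = ℕD._∣_.quotient (proj₁ (proj₂ dream))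
  x^p+M+1 : suc x ^ p ≡ x ^ p ℕ.+ q ℕ.* p ℕ.+ 1
  x^p+M+1 = trans (proj₂ (proj₂ dream)) (cong (λ M → x ^ p ℕ.+ M ℕ.+ 1) (ℕD._∣_.equality (proj₁ (proj₂ dream))))
  shuffle : ∀ a q p → a + q * p + 1ℤ ≡ a + 1ℤ + p * q
  shuffle = solve-∀

≈0⇒∣ : ∀ {n x} → x ≈ 0ℤ [mod n ] → n ∣ ℤ.∣ x ∣
≈0⇒∣ {n} {x} x≈0 = subst (n ∣_) (cong ℤ.∣_∣ (ℤP.+-identityʳ x)) (unwrap x≈0)

∣⇒≈0 : ∀ {n x} → n ∣ ℤ.∣ x ∣ → x ≈ 0ℤ [mod n ]
∣⇒≈0 {n} {x} n∣x = wrap (subst (n ∣_) (cong ℤ.∣_∣ (sym (ℤP.+-identityʳ x))) n∣x)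

-≈0⇒≈ : ∀ {n x y} → x - y ≈ 0ℤ [mod n ] → x ≈ y [mod n ]
-≈0⇒≈ x-y≈0 = wrap (≈0⇒∣ x-y≈0)

≈⇒-≈0 : ∀ {n x y} → x ≈ y [mod n ] → x - y ≈ 0ℤ [mod n ]
≈⇒-≈0 x≈y = ∣⇒≈0 (unwrap x≈y)

prime-≈0 : ∀ {p x y} → Prime p → x * y ≈ 0ℤ [mod p ] → x ≈ 0ℤ [mod p ] ⊎ y ≈ 0ℤ [mod p ]
prime-≈0 {p} {x} {y} pp xy≈0 =
  Sum.map ∣⇒≈0 ∣⇒≈0 (euclidsLemma ℤ.∣ x ∣ ℤ.∣ y ∣ pp (subst (p ∣_) (ℤP.abs-* x y) (≈0⇒∣ xy≈0)))

prime-cancelˡ : ∀ {p x y z} → Prime p → ¬ (x ≈ 0ℤ [mod p ]) → x * y ≈ x * z [mod p ] → y ≈ z [mod p ]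
prime-cancelˡ {p} {x} {y} {z} pp x≉0 xy≈xz =
  [ (λ x≈0 → contradiction x≈0 x≉0) , -≈0⇒≈ ]′ (prime-≈0 pp (≈-trans (≡⇒≈ (distrib x y z)) (≈⇒-≈0 xy≈xz)))
  where
  distrib : ∀ x y z → x * (y - z) ≡ x * y - x * z
  distrib = solve-∀

prime∤1 : ∀ {p} → Prime p → ¬ (1ℤ ≈ 0ℤ [mod p ])
prime∤1 pp 1≈0 = ℕP.>⇒≢ (prime>1 pp) (ℕD.∣1⇒≡1 (≈0⇒∣ 1≈0))

-- Lagrange's bound on the number of roots modulo a prime

-- monic (c₀ ∷ … ∷ c_{d-1} ∷ []) x = c₀ + c₁ x + ⋯ + c_{d-1} x^{d-1} + x^d
monic : List ℤ → ℤ → ℤ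
monic [] x = 1ℤ
monic (c ∷ cs) x = c + x * monic cs x

-- synthetic division of monic (c ∷ cs) by x − a
deflate : ℤ → List ℤ → List ℤ
deflate a [] = []
deflate a (c ∷ cs) = monic (c ∷ cs) a ∷ deflate a cs

length-deflate : ∀ a cs → length (deflate a cs) ≡ length cs
length-deflate a [] = refl
length-deflate a (c ∷ cs) = cong suc (length-deflate a cs)

monic-factor : ∀ a c cs x → monic (c ∷ cs) x ≡ (x - a) * monic (deflate a cs) x + monic (c ∷ cs) a
monic-factor a c [] x = last c x a
  where
  last : ∀ c x a → c + x * 1ℤ ≡ (x - a) * 1ℤ + (c + a * 1ℤ)
  last = solve-∀
monic-factor a c (c′ ∷ cs) x = begin
  c + x * monic (c′ ∷ cs) x                                    ≡⟨ cong (λ t → c + x * t) (monic-factor a c′ cs x) ⟩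
  c + x * ((x - a) * Q + A)                                    ≡⟨ regroup c x a Q A ⟩
  (x - a) * (A + x * Q) + (c + a * A)                          ∎
  where
  open ≡-Reasoning
  A = monic (c′ ∷ cs) a
  Q = monic (deflate a cs) x
  regroup : ∀ c x a Q A → c + x * ((x - a) * Q + A) ≡ (x - a) * (A + x * Q) + (c + a * A)
  regroup = solve-∀

deflate-root : ∀ {p a b} c cs → Prime p → ¬ (a ≈ b [mod p ]) → monic (c ∷ cs) a ≈ 0ℤ [mod p ] →
               monic (c ∷ cs) b ≈ 0ℤ [mod p ] → monic (deflate a cs) b ≈ 0ℤ [mod p ]
deflate-root {p} {a} {b} c cs pp a≉b Pa≈0 Pb≈0 =
  [ (λ b-a≈0 → contradiction (≈-sym (-≈0⇒≈ b-a≈0)) a≉b) , (λ Qb≈0 → Qb≈0) ]′ (prime-≈0 pp (begin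
    (b - a) * Q                            ≡⟨ ℤP.+-identityʳ _ ⟨
    (b - a) * Q + 0ℤ                       ≈⟨ ≈-+ (≈-refl {x = (b - a) * Q}) Pa≈0 ⟨
    (b - a) * Q + monic (c ∷ cs) a         ≡⟨ monic-factor a c cs b ⟨
    monic (c ∷ cs) b                       ≈⟨ Pb≈0 ⟩
    0ℤ                                     ∎))
  where
  open ≈-Reasoning (≈-setoid p)
  Q = monic (deflate a cs) b

root-bound : ∀ {p} → Prime p → ∀ cs xs → UniqueUpTo (≈-setoid p) xs →
             All (λ x → monic cs x ≈ 0ℤ [mod p ]) xs → length xs ≤ length cs
root-bound pp cs [] _ _ = z≤n
root-bound pp [] (x ∷ xs) _ (1≈0 ∷ _) = contradiction 1≈0 (prime∤1 pp)
root-bound pp (c ∷ cs) (a ∷ xs) (a≉xs ∷ unique) (Pa≈0 ∷ Pxs≈0) =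
  s≤s (subst (length xs ≤_) (length-deflate a cs) (root-bound pp (deflate a cs) xs unique
    (All.map (λ (a≉b , Pb≈0) → deflate-root c cs pp a≉b Pa≈0 Pb≈0) (All.zip (a≉xs , Pxs≈0)))))

-- Roots of Φ₃ modulo prime powers

_≈?_[mod_] : ∀ x y n → Dec (x ≈ y [mod n ])
x ≈? y [mod n ] = Dec.map′ wrap unwrap (n ℕD.∣? ℤ.∣ x - y ∣)

cube≈1⇒root : ∀ {p y} → Prime p → y ℤ.^ 3 ≈ 1ℤ [mod p ] → ¬ (y ≈ 1ℤ [mod p ]) → Root p y
cube≈1⇒root {p} {y} pp y³≈1 y≉1 =
  [ (λ y-1≈0 → contradiction (-≈0⇒≈ y-1≈0) y≉1) , (λ Φ₃y≈0 → Φ₃y≈0) ]′ (prime-≈0 pp (begin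
    (y - 1ℤ) * Φ₃ y          ≡⟨ factor y ⟩
    y ℤ.^ 3 - 1ℤ             ≈⟨ ≈⇒-≈0 y³≈1 ⟩
    0ℤ                       ∎))
  where
  open ≈-Reasoning (≈-setoid p)
  factor : ∀ y → (y - 1ℤ) * (y * y + y + 1ℤ) ≡ y * (y * (y * 1ℤ)) - 1ℤ
  factor = solve-∀

fermat-unit : ∀ {p x} n → Prime p → p ≡ suc (n ℕ.* 3) → 0 < x → x < p → ((+ x) ℤ.^ n) ℤ.^ 3 ≈ 1ℤ [mod p ]
fermat-unit {p} {x} n pp refl 0<x x<p = ≈-trans (≡⇒≈ (ℤP.^-*-assoc (+ x) n 3))
  (prime-cancelˡ pp x≉0 (≈-trans (fermat pp x) (≡⇒≈ (sym (ℤP.*-identityʳ (+ x))))))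
  where
  x≉0 : ¬ (+ x ≈ 0ℤ [mod p ])
  x≉0 x≈0 = ℕP.>⇒≢ 0<x (≈⇒≡ x<p (ℕP.<-trans 0<x x<p) x≈0)

monic-replicate-0 : ∀ k x → monic (replicate k 0ℤ) x ≡ x ℤ.^ k
monic-replicate-0 zero x = refl
monic-replicate-0 (suc k) x = trans (ℤP.+-identityˡ _) (cong (x *_) (monic-replicate-0 k x))

root-mod-prime : ∀ {p} n → Prime p → p ≡ suc (n ℕ.* 3) → Σ ℤ (Root p)
root-mod-prime zero pp p≡1 = contradiction p≡1 (ℕP.>⇒≢ (prime>1 pp))
root-mod-prime {p} n@(suc n′) pp p≡1+3n = decide (all? (λ x → (x ℤ.^ n) ≈? 1ℤ [mod p ]) units)
  where
  open ≈-Reasoning (≈-setoid p)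
  units : List ℤ
  units = applyUpTo (λ i → + suc i) (n ℕ.* 3)
  units-distinct : UniqueUpTo (≈-setoid p) units
  units-distinct = applyUpTo⁺₁ (≈-setoid p) (λ i → + suc i) (n ℕ.* 3) λ {i} {j} i<j j<3n i≈j →
    ℕP.<⇒≢ i<j (ℕP.suc-injective (≈⇒≡ (lt (ℕP.<-trans i<j j<3n)) (lt j<3n) i≈j))
    where
    lt : ∀ {i} → i < n ℕ.* 3 → suc i < p
    lt i<3n = subst (suc _ <_) (sym p≡1+3n) (s≤s i<3n)
  xⁿ-1 : List ℤ
  xⁿ-1 = - 1ℤ ∷ replicate n′ 0ℤ
  root-of-xⁿ-1 : ∀ {x} → x ℤ.^ n ≈ 1ℤ [mod p ] → monic xⁿ-1 x ≈ 0ℤ [mod p ]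
  root-of-xⁿ-1 {x} xⁿ≈1 = begin
    - 1ℤ + x * monic (replicate n′ 0ℤ) x     ≡⟨ cong (λ t → - 1ℤ + x * t) (monic-replicate-0 n′ x) ⟩
    - 1ℤ + x ℤ.^ n                           ≈⟨ ≈-+ (≈-refl {x = - 1ℤ}) xⁿ≈1 ⟩
    0ℤ                                       ∎
  decide : Dec (All (λ x → (x ℤ.^ n) ≈ 1ℤ [mod p ]) units) → Σ ℤ (Root p)
  decide (no ¬all) =
    let i , i<3n , y≉1 = applyUpTo⁻ {P = λ x → ¬ (x ℤ.^ n ≈ 1ℤ [mod p ])} (λ i → + suc i) {n ℕ.* 3}
                           (¬All⇒Any¬ (λ x → (x ℤ.^ n) ≈? 1ℤ [mod p ]) units ¬all)
    in (+ suc i) ℤ.^ n , cube≈1⇒root pp (fermat-unit n pp p≡1+3n (s≤s z≤n) (subst (suc i <_) (sym p≡1+3n) (s≤s i<3n))) y≉1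
  decide (yes all) = contradiction
    (subst₂ _≤_ (length-applyUpTo (λ i → + suc i) (n ℕ.* 3)) (cong suc (length-replicate n′))
      (root-bound pp xⁿ-1 units units-distinct (All.map (λ {x} → root-of-xⁿ-1 {x}) all)))
    (ℕP.<⇒≱ (ℕP.m<m*n n 3 (s≤s (s≤s z≤n))))

-- Newton's step r ↦ r − Φ₃(r)·w, with w an inverse of Φ₃′(r) = 2r + 1 modulo p.
newton-step : ∀ r c w d e P p → Φ₃ r ≡ P * c → 1ℤ - (r + r + 1ℤ) * w ≡ p * d → P ≡ e * p →
              Φ₃ (r - c * w * P) ≡ (c * d + c * c * w * w * e) * (p * P)
newton-step r c w d e P p Φ₃r≡Pc 1-[2r+1]w≡pd P≡ep = begin
  Φ₃ (r - c * w * P)                                                ≡⟨ expand r c w P ⟩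
  Φ₃ r - P * c * ((r + r + 1ℤ) * w) + (c * w * P) * (c * w * P)     ≡⟨ cong (λ t → t - P * c * ((r + r + 1ℤ) * w) + (c * w * P) * (c * w * P)) Φ₃r≡Pc ⟩
  P * c - P * c * ((r + r + 1ℤ) * w) + (c * w * P) * (c * w * P)    ≡⟨ collect P c r w ⟩
  P * c * (1ℤ - (r + r + 1ℤ) * w) + (c * w * P) * (c * w * P)       ≡⟨ cong₂ (λ s t → P * c * s + (c * w * t) * (c * w * P)) 1-[2r+1]w≡pd P≡ep ⟩
  P * c * (p * d) + (c * w * (e * p)) * (c * w * P)                 ≡⟨ factor P p e c d w ⟩
  (c * d + c * c * w * w * e) * (p * P)                             ∎
  where
  open ≡-Reasoning
  expand : ∀ r c w P → (r - c * w * P) * (r - c * w * P) + (r - c * w * P) + 1ℤ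
                     ≡ (r * r + r + 1ℤ) - P * c * ((r + r + 1ℤ) * w) + (c * w * P) * (c * w * P)
  expand = solve-∀
  collect : ∀ P c r w → P * c - P * c * ((r + r + 1ℤ) * w) + (c * w * P) * (c * w * P)
                      ≡ P * c * (1ℤ - (r + r + 1ℤ) * w) + (c * w * P) * (c * w * P)
  collect = solve-∀
  factor : ∀ P p e c d w → P * c * (p * d) + (c * w * (e * p)) * (c * w * P) ≡ (c * d + c * c * w * w * e) * (p * P)
  factor = solve-∀

hensel : ∀ {p P r w} → p ∣ P → (r + r + 1ℤ) * w ≈ 1ℤ [mod p ] → Root P r → Σ ℤ (Root (p ℕ.* P))
hensel {p} {P} {r} {w} (ℕD.divides e P≡ep) w-inverse root =
  let c , Φ₃r≡0+Pc = ≈⇒+multiple (≈-sym root)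
      d , 1≡[2r+1]w+pd = ≈⇒+multiple w-inverse
  in r - c * w * + P , Φ₃≡*⇒Root (r - c * w * + P) (c * d + c * c * w * w * + e) (trans
       (newton-step r c w d (+ e) (+ P) (+ p)
          (trans Φ₃r≡0+Pc (ℤP.+-identityˡ _))
          (trans (cong (_- (r + r + 1ℤ) * w) 1≡[2r+1]w+pd) (cancel ((r + r + 1ℤ) * w) (+ p * d)))
          (trans (cong +_ P≡ep) (ℤP.pos-* e p)))
       (cong ((c * d + c * c * w * w * + e) *_) (sym (ℤP.pos-* p P))))
  where
  cancel : ∀ a b → a + b - a ≡ b
  cancel = solve-∀

-- (2r + 1)² = 4 Φ₃(r) − 3 and 3n = p − 1 make (2r + 1)·n an inverse of 2r + 1.
derivative-inverse : ∀ {p r} n → p ≡ suc (n ℕ.* 3) → Root p r → (r + r + 1ℤ) * ((r + r + 1ℤ) * + n) ≈ 1ℤ [mod p ]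
derivative-inverse {p} {r} n refl root = begin
  (r + r + 1ℤ) * ((r + r + 1ℤ) * + n)                        ≡⟨ discriminant r (+ n) ⟩
  + n * + 4 * Φ₃ r + 1ℤ + - 1ℤ * (1ℤ + + n * + 3)            ≡⟨ cong (λ t → + n * + 4 * Φ₃ r + 1ℤ + - 1ℤ * (1ℤ + t)) (ℤP.pos-* n 3) ⟨
  + n * + 4 * Φ₃ r + 1ℤ + - 1ℤ * + p                         ≈⟨ ≈-+ (≈-+ (≈-*ˡ (+ n * + 4) root) (≈-refl {x = 1ℤ})) (*n≈0 (- 1ℤ)) ⟩
  + n * + 4 * 0ℤ + 1ℤ + 0ℤ                                   ≡⟨ vanish (+ n * + 4) ⟩
  1ℤ                                                         ∎
  where
  open ≈-Reasoning (≈-setoid p)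
  discriminant : ∀ r n → (r + r + 1ℤ) * ((r + r + 1ℤ) * n) ≡ n * + 4 * (r * r + r + 1ℤ) + 1ℤ + - 1ℤ * (1ℤ + n * + 3)
  discriminant = solve-∀
  vanish : ∀ x → x * 0ℤ + 1ℤ + 0ℤ ≡ 1ℤ
  vanish = solve-∀

root-mod-prime-power : ∀ {p} n → Prime p → p ≡ suc (n ℕ.* 3) → ∀ k → Σ ℤ (Root (p ^ suc k))
root-mod-prime-power {p} n pp p≡1+3n zero =
  let r , root = root-mod-prime n pp p≡1+3n in r , ≈-∣ (ℕD.∣-reflexive (ℕP.*-identityʳ p)) root
root-mod-prime-power {p} n pp p≡1+3n (suc k) =
  let r , root = root-mod-prime-power n pp p≡1+3n k
  in hensel {r = r} {w = (r + r + 1ℤ) * + n} (ℕD.m∣m*n (p ^ k)) (derivative-inverse {r = r} n p≡1+3n (≈-∣ (ℕD.m∣m*n (p ^ k)) root)) root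

residue-setoid : ℕ → Setoid _ _
residue-setoid n = On.setoid (≈-setoid n) (λ a → + a)

-- Distinctness is taken modulo n, the form in which the Chinese remainder map is injective.
ListsRoots : ℕ → List ℕ → Set
ListsRoots n es = UniqueUpTo (residue-setoid n) es × (∀ s → s ∈ es ⇔ (s < n × Root n (+ s)))

coprime-^ : ∀ {p m} → Prime p → ¬ p ∣ m → ∀ j → Coprime (p ^ j) m
coprime-^ pp p∤m zero (i∣1 , _) = ℕD.∣1⇒≡1 i∣1
coprime-^ {p} {m} pp p∤m (suc j) {i} (i∣pʲ⁺¹ , i∣m) = coprime-^ pp p∤m j (coprime-divisor i⊥p i∣pʲ⁺¹ , i∣m)
  where
  i⊥p : Coprime i p
  i⊥p {d} (d∣i , d∣p) = [ (λ d≡1 → d≡1) , (λ { refl → contradiction (ℕD.∣-trans d∣i i∣m) p∤m }) ]′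
                          (prime⇒irreducible pp d∣p)

prime-power-≈0 : ∀ {p x y} j → Prime p → x * y ≈ 0ℤ [mod p ^ j ] → ¬ (y ≈ 0ℤ [mod p ]) → x ≈ 0ℤ [mod p ^ j ]
prime-power-≈0 {p} {x} {y} j pp xy≈0 y≉0 = ∣⇒≈0 (coprime-divisor (coprime-^ pp (λ p∣y → y≉0 (∣⇒≈0 p∣y)) j)
  (subst (p ^ j ∣_) (trans (ℤP.abs-* x y) (ℕP.*-comm ℤ.∣ x ∣ ℤ.∣ y ∣)) (≈0⇒∣ xy≈0)))

-- 3 = 4 Φ₃(r) − (2r + 1)², and p ∤ 3.
root⇒2r+1≉0 : ∀ {p r} → Prime p → p % 3 ≡ 1 → Root p r → ¬ (r + r + 1ℤ ≈ 0ℤ [mod p ])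
root⇒2r+1≉0 {p} {r} pp p%3≡1 root 2r+1≈0 =
  contradiction (subst (λ q → q % 3 ≡ 1) (∣3⇒≡3 (prime>1 pp) (unwrap three≈0)) p%3≡1) λ ()
  where
  open ≈-Reasoning (≈-setoid p)
  three≈0 : + 3 ≈ 0ℤ [mod p ]
  three≈0 = begin
    + 3                                                  ≡⟨ discriminant r ⟩
    + 4 * Φ₃ r + - (r + r + 1ℤ) * (r + r + 1ℤ)           ≈⟨ ≈-+ (≈-*ˡ (+ 4) root) (≈-*ˡ (- (r + r + 1ℤ)) 2r+1≈0) ⟩
    + 4 * 0ℤ + - (r + r + 1ℤ) * 0ℤ                       ≡⟨ vanish (r + r + 1ℤ) ⟩
    0ℤ                                                   ∎
    where
    discriminant : ∀ r → + 3 ≡ + 4 * (r * r + r + 1ℤ) + - (r + r + 1ℤ) * (r + r + 1ℤ)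
    discriminant = solve-∀
    vanish : ∀ a → + 4 * 0ℤ + - a * 0ℤ ≡ 0ℤ
    vanish = solve-∀

Root-conj : ∀ {n r} → Root n r → Root n (- 1ℤ - r)
Root-conj {r = r} root = ≈-trans (≡⇒≈ (conj r)) root
  where
  conj : ∀ r → (- 1ℤ - r) * (- 1ℤ - r) + (- 1ℤ - r) + 1ℤ ≡ r * r + r + 1ℤ
  conj = solve-∀

-- p cannot divide both factors of Φ₃(s) − Φ₃(r) = (s − r)(s + r + 1), as it does not divide 2r + 1.
roots-mod-prime-power : ∀ {p r s} k → Prime p → p % 3 ≡ 1 → Root (p ^ suc k) r → Root (p ^ suc k) s →
                        s ≈ r [mod p ^ suc k ] ⊎ s ≈ - 1ℤ - r [mod p ^ suc k ]
roots-mod-prime-power {p} {r} {s} k pp p%3≡1 root-r root-s = factor-vanishes ((s + r + 1ℤ) ≈? 0ℤ [mod p ])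
  where
  open ≈-Reasoning (≈-setoid (p ^ suc k))
  2r+1≉0 : ¬ (r + r + 1ℤ ≈ 0ℤ [mod p ])
  2r+1≉0 = root⇒2r+1≉0 {r = r} pp p%3≡1 (≈-∣ (ℕD.m∣m*n (p ^ k)) root-r)
  product≈0 : (s - r) * (s + r + 1ℤ) ≈ 0ℤ [mod p ^ suc k ]
  product≈0 = begin
    (s - r) * (s + r + 1ℤ)     ≡⟨ difference s r ⟩
    Φ₃ s - Φ₃ r                ≈⟨ ≈⇒-≈0 (≈-trans root-s (≈-sym root-r)) ⟩
    0ℤ                         ∎
    where
    difference : ∀ s r → (s - r) * (s + r + 1ℤ) ≡ (s * s + s + 1ℤ) - (r * r + r + 1ℤ)
    difference = solve-∀
  factor-vanishes : Dec (s + r + 1ℤ ≈ 0ℤ [mod p ]) → s ≈ r [mod p ^ suc k ] ⊎ s ≈ - 1ℤ - r [mod p ^ suc k ]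
  factor-vanishes (no s+r+1≉0) = inj₁ (-≈0⇒≈ (prime-power-≈0 (suc k) pp product≈0 s+r+1≉0))
  factor-vanishes (yes s+r+1≈0) = inj₂ (-≈0⇒≈ (≈-trans (≡⇒≈ (shift s r))
    (prime-power-≈0 (suc k) pp (≈-trans (≡⇒≈ (ℤP.*-comm (s + r + 1ℤ) (s - r))) product≈0) s-r≉0)))
    where
    shift : ∀ s r → s - (- 1ℤ - r) ≡ s + r + 1ℤ
    shift = solve-∀
    split : ∀ s r → r + r + 1ℤ ≡ (s + r + 1ℤ) + - 1ℤ * (s - r)
    split = solve-∀
    s-r≉0 : ¬ (s - r ≈ 0ℤ [mod p ])
    s-r≉0 s-r≈0 = 2r+1≉0 (≈-trans (≡⇒≈ (split s r)) (≈-+ s+r+1≈0 (≈-*ˡ (- 1ℤ) s-r≈0)))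

two-roots : ∀ {p r} k → Prime p → p % 3 ≡ 1 → Root (p ^ suc k) r →
            Σ (List ℕ) λ es → length es ≡ 2 × ListsRoots (p ^ suc k) es
two-roots {p} {r} k pp p%3≡1 root = r₁ ∷ r₂ ∷ [] , refl , ((r₁≉r₂ ∷ []) ∷ [] ∷ []) , λ s → mk⇔ (to s) (from s)
  where
  q = p ^ suc k
  instance
    p≢0 : NonZero p
    p≢0 = prime⇒nonZero pp
    q≢0 : NonZero q
    q≢0 = ℕP.m^n≢0 p (suc k)
  r₁ = r ℤM.%ℕ q
  r₂ = (- 1ℤ - r) ℤM.%ℕ q
  r₁≉r₂ : ¬ (+ r₁ ≈ + r₂ [mod q ])
  r₁≉r₂ r₁≈r₂ = root⇒2r+1≉0 {r = r} pp p%3≡1 (≈-∣ p∣q root) (≈-∣ p∣q (≈-trans (≡⇒≈ (twice r)) (≈⇒-≈0 (begin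
    r          ≈⟨ %ℕ≈ r q ⟨
    + r₁       ≈⟨ r₁≈r₂ ⟩
    + r₂       ≈⟨ %ℕ≈ (- 1ℤ - r) q ⟩
    - 1ℤ - r   ∎))))
    where
    open ≈-Reasoning (≈-setoid q)
    p∣q : p ∣ q
    p∣q = ℕD.m∣m*n (p ^ k)
    twice : ∀ r → r + r + 1ℤ ≡ r - (- 1ℤ - r)
    twice = solve-∀
  to : ∀ s → s ∈ r₁ ∷ r₂ ∷ [] → s < q × Root q (+ s)
  to s (here refl) = ℤM.n%ℕd<d r q , Root-cong {y = + r₁} (≈-sym (%ℕ≈ r q)) root
  to s (there (here refl)) = ℤM.n%ℕd<d (- 1ℤ - r) q , Root-cong {y = + r₂} (≈-sym (%ℕ≈ (- 1ℤ - r) q)) (Root-conj {r = r} root)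
  from : ∀ s → s < q × Root q (+ s) → s ∈ r₁ ∷ r₂ ∷ []
  from s (s<q , root-s) =
    [ (λ s≈r → here (≈⇒≡ s<q (ℤM.n%ℕd<d r q) (≈-trans s≈r (≈-sym (%ℕ≈ r q)))))
    , (λ s≈r̄ → there (here (≈⇒≡ s<q (ℤM.n%ℕd<d (- 1ℤ - r) q) (≈-trans s≈r̄ (≈-sym (%ℕ≈ (- 1ℤ - r) q))))))
    ]′ (roots-mod-prime-power {r = r} {+ s} k pp p%3≡1 root root-s)

-- The Chinese remainder theorem

coprime∧∣⇒*∣ : ∀ {q m n} → Coprime q m → q ∣ n → m ∣ n → q ℕ.* m ∣ n
coprime∧∣⇒*∣ {q} {m} {n} q⊥m q∣n m∣n = subst (_∣ n) lcm≡q*m (lcm-least q∣n m∣n)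
  where
  lcm≡q*m : lcm q m ≡ q ℕ.* m
  lcm≡q*m = trans (sym (ℕP.*-identityˡ (lcm q m))) (trans (cong (ℕ._* lcm q m) (sym (coprime⇒gcd≡1 q⊥m))) (gcd*lcm q m))

≈-combine : ∀ {q m x y} → Coprime q m → x ≈ y [mod q ] → x ≈ y [mod m ] → x ≈ y [mod q ℕ.* m ]
≈-combine q⊥m x≈y y≈z = wrap (coprime∧∣⇒*∣ q⊥m (unwrap x≈y) (unwrap y≈z))

length-cartesianProductWith : ∀ {A B C : Set} (f : A → B → C) xs ys →
                              length (cartesianProductWith f xs ys) ≡ length xs ℕ.* length ys
length-cartesianProductWith f [] ys = refl
length-cartesianProductWith f (x ∷ xs) ys = begin
  length (map (f x) ys ++ cartesianProductWith f xs ys)          ≡⟨ length-++ (map (f x) ys) ⟩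
  length (map (f x) ys) ℕ.+ length (cartesianProductWith f xs ys) ≡⟨ cong₂ ℕ._+_ (length-map (f x) ys) (length-cartesianProductWith f xs ys) ⟩
  length ys ℕ.+ length xs ℕ.* length ys                          ∎
  where open ≡-Reasoning

module CRT {q m : ℕ} (q⊥m : Coprime q m) .{{_ : NonZero q}} .{{_ : NonZero m}} where

  instance
    qm≢0 : NonZero (q ℕ.* m)
    qm≢0 = ℕP.m*n≢0 q m

  private
    u = proj₁ (coprime⇒bézout q⊥m)
    v = proj₁ (proj₂ (coprime⇒bézout q⊥m))
    bézout : u * + q + v * + m ≡ 1ℤ
    bézout = proj₂ (proj₂ (coprime⇒bézout q⊥m))

    lift : ℕ → ℕ → ℤ
    lift a b = + a * (v * + m) + + b * (u * + q)

  crt : ℕ → ℕ → ℕ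
  crt a b = lift a b ℤM.%ℕ (q ℕ.* m)

  crt< : ∀ a b → crt a b < q ℕ.* m
  crt< a b = ℤM.n%ℕd<d (lift a b) (q ℕ.* m)

  crt≈ˡ : ∀ a b → + crt a b ≈ + a [mod q ]
  crt≈ˡ a b = begin
    + crt a b                                          ≈⟨ ≈-∣ (ℕD.m∣m*n m) (%ℕ≈ (lift a b) (q ℕ.* m)) ⟩
    lift a b                                           ≡⟨ regroup (+ a) (+ b) u v (+ q) (+ m) ⟩
    + a * (u * + q + v * + m) + + q * ((+ b - + a) * u) ≡⟨ cong (λ t → + a * t + + q * ((+ b - + a) * u)) bézout ⟩
    + a * 1ℤ + + q * ((+ b - + a) * u)                  ≈⟨ +-multiple≈ (+ a * 1ℤ) ((+ b - + a) * u) ⟩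
    + a * 1ℤ                                           ≡⟨ ℤP.*-identityʳ (+ a) ⟩
    + a                                                ∎
    where
    open ≈-Reasoning (≈-setoid q)
    regroup : ∀ a b u v q m → a * (v * m) + b * (u * q) ≡ a * (u * q + v * m) + q * ((b - a) * u)
    regroup = solve-∀

  crt≈ʳ : ∀ a b → + crt a b ≈ + b [mod m ]
  crt≈ʳ a b = begin
    + crt a b                                          ≈⟨ ≈-∣ (ℕD.n∣m*n q) (%ℕ≈ (lift a b) (q ℕ.* m)) ⟩
    lift a b                                           ≡⟨ regroup (+ a) (+ b) u v (+ q) (+ m) ⟩
    + b * (u * + q + v * + m) + + m * ((+ a - + b) * v) ≡⟨ cong (λ t → + b * t + + m * ((+ a - + b) * v)) bézout ⟩
    + b * 1ℤ + + m * ((+ a - + b) * v)                  ≈⟨ +-multiple≈ (+ b * 1ℤ) ((+ a - + b) * v) ⟩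
    + b * 1ℤ                                           ≡⟨ ℤP.*-identityʳ (+ b) ⟩
    + b                                                ∎
    where
    open ≈-Reasoning (≈-setoid m)
    regroup : ∀ a b u v q m → a * (v * m) + b * (u * q) ≡ b * (u * q + v * m) + m * ((a - b) * v)
    regroup = solve-∀

  crt-injective : ∀ {a a′ b b′} → + crt a b ≈ + crt a′ b′ [mod q ℕ.* m ] → + a ≈ + a′ [mod q ] × + b ≈ + b′ [mod m ]
  crt-injective {a} {a′} {b} {b′} eq =
    ≈-trans (≈-sym (crt≈ˡ a b)) (≈-trans (≈-∣ (ℕD.m∣m*n m) eq) (crt≈ˡ a′ b′)) ,
    ≈-trans (≈-sym (crt≈ʳ a b)) (≈-trans (≈-∣ (ℕD.n∣m*n q) eq) (crt≈ʳ a′ b′))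

  crt-surjective : ∀ {r} → r < q ℕ.* m → r ≡ crt ((+ r) ℤM.%ℕ q) ((+ r) ℤM.%ℕ m)
  crt-surjective {r} r<qm = ≈⇒≡ r<qm (crt< a b) (≈-combine q⊥m
    (≈-sym (≈-trans (crt≈ˡ a b) (%ℕ≈ (+ r) q)))
    (≈-sym (≈-trans (crt≈ʳ a b) (%ℕ≈ (+ r) m))))
    where
    a = (+ r) ℤM.%ℕ q
    b = (+ r) ℤM.%ℕ m

  ListsRoots-* : ∀ {eq em} → ListsRoots q eq → ListsRoots m em → ListsRoots (q ℕ.* m) (cartesianProductWith crt eq em)
  ListsRoots-* {eq} {em} (eq-unique , eq-roots) (em-unique , em-roots) =
    cartesianProductWith⁺ (residue-setoid q) (residue-setoid m) (residue-setoid (q ℕ.* m)) crt crt-injective eq-unique em-unique ,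
    λ r → mk⇔ (to r) (from r)
    where
    to : ∀ r → r ∈ cartesianProductWith crt eq em → r < q ℕ.* m × Root (q ℕ.* m) (+ r)
    to r r∈ with ∈-cartesianProductWith⁻ crt eq em r∈
    ... | a , b , a∈ , b∈ , refl =
      crt< a b , ≈-combine q⊥m
        (Root-cong {y = + crt a b} (≈-sym (crt≈ˡ a b)) (proj₂ (Equivalence.to (eq-roots a) a∈)))
        (Root-cong {y = + crt a b} (≈-sym (crt≈ʳ a b)) (proj₂ (Equivalence.to (em-roots b) b∈)))
    from : ∀ r → r < q ℕ.* m × Root (q ℕ.* m) (+ r) → r ∈ cartesianProductWith crt eq em
    from r (r<qm , root) = subst (_∈ cartesianProductWith crt eq em) (sym (crt-surjective r<qm))
      (∈-cartesianProductWith⁺ crt (residue-∈ q eq-roots (ℕD.m∣m*n m)) (residue-∈ m em-roots (ℕD.n∣m*n q)))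
      where
      residue-∈ : ∀ n {es} .{{_ : NonZero n}} → (∀ s → s ∈ es ⇔ (s < n × Root n (+ s))) → n ∣ q ℕ.* m → (+ r) ℤM.%ℕ n ∈ es
      residue-∈ n roots n∣qm = Equivalence.from (roots _)
        (ℤM.n%ℕd<d (+ r) n , Root-cong {y = + ((+ r) ℤM.%ℕ n)} (≈-sym (%ℕ≈ (+ r) n)) (≈-∣ n∣qm root))

-- Counting the roots

prime∣p^j⇒≡ : ∀ {p r} j → Prime p → Prime r → r ∣ p ^ j → r ≡ p
prime∣p^j⇒≡ zero pp pr r∣1 = contradiction (ℕD.∣1⇒≡1 r∣1) (ℕP.>⇒≢ (prime>1 pr))
prime∣p^j⇒≡ {p} {r} (suc j) pp pr r∣pʲ⁺¹ =
  [ (λ r∣p → [ (λ r≡1 → contradiction r≡1 (ℕP.>⇒≢ (prime>1 pr))) , (λ r≡p → r≡p) ]′ (prime⇒irreducible pp r∣p))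
  , prime∣p^j⇒≡ j pp pr
  ]′ (euclidsLemma p (p ^ j) pr r∣pʲ⁺¹)

split-prime-power : ∀ {p f} → Prime p → Acc _<_ f → .{{_ : NonZero f}} → p ∣ f →
                    Σ ℕ λ k → Σ ℕ λ m → f ≡ p ^ suc k ℕ.* m × ¬ p ∣ m
split-prime-power {p} {f} pp (acc smaller) (ℕD.divides f′ f≡f′p) = cases (p ℕD.∣? f′)
  where
  instance
    f′≢0 : NonZero f′
    f′≢0 = ℕ.≢-nonZero λ { refl → ℕ.≢-nonZero⁻¹ f f≡f′p }
  f≡p*f′ : f ≡ p ℕ.* f′
  f≡p*f′ = trans f≡f′p (ℕP.*-comm f′ p)
  cases : Dec (p ∣ f′) → Σ ℕ λ k → Σ ℕ λ m → f ≡ p ^ suc k ℕ.* m × ¬ p ∣ m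
  cases (no p∤f′) = 0 , f′ , trans f≡p*f′ (cong (ℕ._* f′) (sym (ℕP.*-identityʳ p))) , p∤f′
  cases (yes p∣f′) =
    let k , m , f′≡pᵏ⁺¹m , p∤m = split-prime-power pp (smaller (subst (f′ <_) (sym f≡f′p) (ℕP.m<m*n f′ p (prime>1 pp)))) p∣f′
    in suc k , m , trans f≡p*f′ (trans (cong (p ℕ.*_) f′≡pᵏ⁺¹m) (sym (ℕP.*-assoc p (p ^ suc k) m))) , p∤m

no-prime-divisor⇒≡1 : ∀ {f} .{{_ : NonZero f}} → (∀ p → Prime p → p ∣ f → p ∈ []) → f ≡ 1
no-prime-divisor⇒≡1 {f} complete = from-factorisation (factorise f)
  where
  from-factorisation : PrimeFactorisation f → f ≡ 1
  from-factorisation record { factors = [] ; isFactorisation = f≡1 } = f≡1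
  from-factorisation record { factors = p ∷ ps ; isFactorisation = f≡p*∏ps ; factorsPrime = pp ∷ _ } =
    contradiction (complete p pp (ℕD.divides (product ps) (trans f≡p*∏ps (ℕP.*-comm p (product ps))))) λ ()

roots-mod-1 : ListsRoots 1 (0 ∷ [])
roots-mod-1 = ([] ∷ []) , λ s → mk⇔ (λ { (here refl) → s≤s z≤n , wrap (ℕD.1∣ _) }) (λ (s<1 , _) → here (ℕP.n<1⇒n≡0 s<1))

cofactor-prime-divisors : ∀ {p ps f m} k → f ≡ p ^ suc k ℕ.* m → ¬ p ∣ m →
  DistinctPrimeDivisors f (p ∷ ps) → DistinctPrimeDivisors m ps
cofactor-prime-divisors {p} {ps} {f} {m} k f≡pᵏ⁺¹m p∤m (p∉ps ∷ ps-unique , (pp , _) ∷ ps-divide , complete) =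
  ps-unique , All.map divides-m (All.zip (p∉ps , ps-divide)) , complete-m
  where
  m∣f : m ∣ f
  m∣f = ℕD.divides (p ^ suc k) f≡pᵏ⁺¹m
  divides-m : ∀ {r} → (p ≢ r) × (Prime r × r ∣ f) → Prime r × r ∣ m
  divides-m {r} (p≢r , pr , r∣f) = pr , [ (λ r∣pᵏ⁺¹ → contradiction (sym (prime∣p^j⇒≡ (suc k) pp pr r∣pᵏ⁺¹)) p≢r) , (λ r∣m → r∣m) ]′
                                          (euclidsLemma (p ^ suc k) m pr (subst (r ∣_) f≡pᵏ⁺¹m r∣f))
  complete-m : ∀ r → Prime r → r ∣ m → r ∈ ps
  complete-m r pr r∣m with complete r pr (ℕD.∣-trans r∣m m∣f)
  ... | here refl = contradiction r∣m p∤m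
  ... | there r∈ps = r∈ps

count-roots : ∀ ps {f} .{{_ : NonZero f}} → OneModThreePrimeFactors f → DistinctPrimeDivisors f ps →
              Σ (List ℕ) λ es → length es ≡ 2 ^ length ps × ListsRoots f es
count-roots [] _ (_ , _ , complete) = 0 ∷ [] , refl , subst (λ n → ListsRoots n (0 ∷ [])) (sym (no-prime-divisor⇒≡1 complete)) roots-mod-1
count-roots (p ∷ ps) {f} one-mod-3 dpd@(_ , (pp , p∣f) ∷ _ , _) =
  let k , m , f≡pᵏ⁺¹m , p∤m = split-prime-power pp (<-wellFounded f) p∣f
  in combine k m f≡pᵏ⁺¹m p∤m
  where
  instance
    p≢0 : NonZero p
    p≢0 = prime⇒nonZero pp
  p≡1+3n : p ≡ suc (p ℕM./ 3 ℕ.* 3)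
  p≡1+3n = trans (ℕM.m≡m%n+[m/n]*n p 3) (cong (ℕ._+ p ℕM./ 3 ℕ.* 3) (one-mod-3 p pp p∣f))
  combine : ∀ k m → f ≡ p ^ suc k ℕ.* m → ¬ p ∣ m → Σ (List ℕ) λ es → length es ≡ 2 ^ length (p ∷ ps) × ListsRoots f es
  combine k m f≡pᵏ⁺¹m p∤m =
    let r , root = root-mod-prime-power (p ℕM./ 3) pp p≡1+3n k
        es₂ , length≡2 , roots-pᵏ⁺¹ = two-roots {r = r} k pp (one-mod-3 p pp p∣f) root
        esₘ , length≡2^|ps| , roots-m = count-roots ps (λ r pr r∣m → one-mod-3 r pr (ℕD.∣-trans r∣m m∣f)) (cofactor-prime-divisors k f≡pᵏ⁺¹m p∤m dpd)
    in cartesianProductWith (CRT.crt pᵏ⁺¹⊥m) es₂ esₘ ,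
       trans (length-cartesianProductWith (CRT.crt pᵏ⁺¹⊥m) es₂ esₘ) (cong₂ ℕ._*_ length≡2 length≡2^|ps|) ,
       subst (λ n → ListsRoots n (cartesianProductWith (CRT.crt pᵏ⁺¹⊥m) es₂ esₘ)) (sym f≡pᵏ⁺¹m) (CRT.ListsRoots-* pᵏ⁺¹⊥m roots-pᵏ⁺¹ roots-m)
    where
    m∣f : m ∣ f
    m∣f = ℕD.divides (p ^ suc k) f≡pᵏ⁺¹m
    instance
      pᵏ⁺¹≢0 : NonZero (p ^ suc k)
      pᵏ⁺¹≢0 = ℕP.m^n≢0 p (suc k)
      m≢0 : NonZero m
      m≢0 = ℕ.≢-nonZero λ { refl → ℕ.≢-nonZero⁻¹ f (trans f≡pᵏ⁺¹m (ℕP.*-zeroʳ (p ^ suc k))) }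
    pᵏ⁺¹⊥m = coprime-^ pp p∤m (suc k)

InE⇔root : ∀ {f} .{{_ : NonZero f}} r → InE f r ⇔ (r < f × Root f (+ r))
InE⇔root {f} r = mk⇔ (λ (r<f , a , b , rep , quot) → r<f , quotient⇒root {f} {a} {b} {+ r} rep quot)
                     (λ (r<f , root) → r<f , root⇒Rep {f} {+ r} root)

lemma4p1 : (f : ℕ) → 1 < f → (∀ p → Prime p → p ∣ f → p % 3 ≡ 1) →
    (ps : List ℕ) → DistinctPrimeDivisors f ps →
    (Σ (List ℕ) (λ es → Unique es × length es ≡ 2 ^ length ps × (∀ r → (r ∈ es) ⇔ InE f r)))
    × (∀ r → InE f r → HasOrder3 f (+ r))
    × (∀ a b → Rep f a b → (δ : ℕ) → 1 ≤ δ → δ ∣ f →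
        Σ ℤ (λ a′ → Σ ℤ (λ b′ → Rep δ a′ b′ × Σ ℤ (λ r → IsQuot δ a b r × IsQuot δ a′ b′ r))))
lemma4p1 f 1<f one-mod-3 ps dpd =
  (let es , length≡2^t , distinct , roots = count-roots ps one-mod-3 dpd
   in es , AllPairs.map (λ r≉s r≡s → r≉s (≡⇒≈ (cong +_ r≡s))) distinct , length≡2^t ,
      λ r → ⇔.trans (roots r) (⇔.sym (InE⇔root r))) ,
  (λ r (_ , a , b , rep , quot) → root⇒order3 (OneModThreePrimeFactors⇒∤3 1<f one-mod-3) (quotient⇒root {f} {a} {b} {+ r} rep quot)) ,
  (λ a b rep δ 1≤δ δ∣f → Rep⇒divisor-Rep {f} {a} {b} {δ} {{ℕ.>-nonZero 1≤δ}} rep δ∣f)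
  where
  instance
    f≢0 : NonZero f
    f≢0 = ℕ.>-nonZero (ℕP.<-trans (s≤s z≤n) 1<f)
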